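{- Consider the PDSTSP setting described in the context. For every subset $S \subseteq V_c$ with $|S| \geq 3$, every feasible PDSTSP solution $(x,y)$ satisfies $$|S| \sum_{(i,j)\in E:\ |\{i,j\}\cap S|=1} x_{ij} \geq 2 \sum_{k \in S} y_k ,$$ where the sum on the left ranges over all edges of $G$ with exactly one endpoint in $S$ (and the other in $V\setminus S$).
   Context: Parallel Drone Scheduling Traveling Salesman Problem (PDSTSP). There is a complete undirected graph $G=(V,E)$ with $V=\{0,1,\dots,n,n+1\}$ and $E=\{(i,j): i,j\in V,\ i<j\}$. Vertex $0$ is the depot and vertex $n+1$ is a copy of the depot. The customers are $V_c=\{1,\dots,n\}$. A subset $V_d\subseteq V_c$ consists of drone-eligible customers, and $V_t=V_c\setminus V_d$ are the customers that must be served by the truck. The variables are binary $x_{ij}$ for edges $(i,j)\in E$ (equal to 1 if the truck travels edge $(i,j)$) and binary $y_i$ for $i \in V$ (equal to 1 if vertex $i$ is visited by the truck), with $y_0=y_{n+1}=1$. Each customer with $y_i=0$ is served by one of the drones via back-and-forth trips from the depot; the drone variables are irrelevant here. A pair $(x,y)$ is a feasible PDSTSP solution if: $y_i=1$ for all $i\in V_t$; and $x$ is the incidence vector of the edge set of a simple path in $G$ from $0$ to $n+1$ whose interior vertices are exactly the customers $i\in V_c$ with $y_i=1$. In particular, every customer $j$ satisfies $\sum_{i<j}x_{ij}+\sum_{k>j}x_{jk}=2y_j$. -}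

module Defs where

open import Data.Nat using (ℕ; zero; suc; _+_; _<?_)
open import Data.Bool using (Bool; true; false; if_then_else_; _xor_; _∧_)
open import Data.Fin using (Fin; zero; suc; toℕ; inject₁; fromℕ)
open import Data.Fin.Subset using (Subset)
open import Data.Vec using (Vec; []; _∷_; lookup)
open import Data.List using (List; []; _∷_; _++_; [_]; map; allFin)
open import Data.Nat.ListAction using (sum)
open import Data.Empty using (⊥)
open import Data.List.Membership.Propositional using (_∈_)
open import Data.List.Relation.Unary.Unique.Propositional using (Unique)
open import Data.Product using (Σ; ∃; _×_)
open import Data.Sum using (_⊎_)
open import Relation.Binary.PropositionalEquality using (_≡_)
open import Relation.Nullary.Decidable using (⌊_⌋)
open import Function.Bundles using (_⇔_)

Vtx : ℕ → Set
Vtx n = Fin (suc (suc n))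

depot : ∀ {n} → Vtx n
depot = zero

depot' : ∀ {n} → Vtx n
depot' {n} = fromℕ (suc n)

-- customer c ∈ Fin n (0-based) is vertex c+1
cust : ∀ {n} → Fin n → Vtx n
cust c = suc (inject₁ c)

IsCustomer : ∀ {n} → Vtx n → Set
IsCustomer {n} v = ∃ λ (c : Fin n) → v ≡ cust c

inS-aux : ∀ {n} → Subset n → Fin (suc n) → Bool
inS-aux [] zero = false
inS-aux (b ∷ S) zero = b
inS-aux (b ∷ S) (suc v) = inS-aux S v

inS : ∀ {n} → Subset n → Vtx n → Bool
inS S zero = false
inS S (suc v) = inS-aux S v

b2n : Bool → ℕ
b2n true = 1
b2n false = 0

Σfin : ∀ m → (Fin m → ℕ) → ℕ
Σfin m f = sum (map f (allFin m))

Consec : {A : Set} → List A → A → A → Set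
Consec [] u v = ⊥
Consec (a ∷ []) u v = ⊥
Consec (a ∷ b ∷ l) u v = (u ≡ a × v ≡ b) ⊎ Consec (b ∷ l) u v

-- Feasible PDSTSP solution (x, y). Vd ⊆ V_c is the set of drone-eligible
-- customers. x i j is only meaningful for toℕ i < toℕ j (edges of E).
Feasible : ∀ n → (Vd : Subset n) → (x : Vtx n → Vtx n → Bool) → (y : Vtx n → Bool) → Set
Feasible n Vd x y =
  (y depot ≡ true) × (y depot' ≡ true) ×
  (∀ (c : Fin n) → lookup Vd c ≡ false → y (cust c) ≡ true) ×
  (Σ (List (Vtx n)) λ interior →
      Unique (depot ∷ interior ++ [ depot' ]) ×
      (∀ v → (v ∈ interior) ⇔ (IsCustomer v × y v ≡ true)) ×
      (∀ (i j : Vtx n) → toℕ i Data.Nat.< toℕ j →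
         (x i j ≡ true) ⇔ (Consec (depot ∷ interior ++ [ depot' ]) i j
                           ⊎ Consec (depot ∷ interior ++ [ depot' ]) j i)))
  where import Data.Nat

cutSum : ∀ n → Subset n → (Vtx n → Vtx n → Bool) → ℕ
cutSum n S x =
  Σfin (suc (suc n)) λ i → Σfin (suc (suc n)) λ j →
    b2n (⌊ toℕ i <? toℕ j ⌋ ∧ (inS S i xor inS S j) ∧ x i j)

ySum : ∀ n → Subset n → (Vtx n → Bool) → ℕ
ySum n S y = Σfin n λ c → b2n (lookup S c ∧ y (cust c))

-- The truck route is a simple path between two vertices outside S. If it visits
-- a customer of S, it must enter S and later leave it, so it uses two distinct
-- edges of the cut δ(S) and the cut sum is at least 2. Together with
-- Σ_{k∈S} y_k ≤ |S| this gives 2 Σ_{k∈S} y_k ≤ 2|S| ≤ |S| · cut sum; if the route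
-- avoids S, the right-hand side is 0.
module Submission where

open import Defs
open import Data.Nat using (ℕ; _*_; _≤_; _≥_; zero; suc; _+_; _<_; _<?_; z≤n; s≤s)
open import Data.Nat.Properties
  using (≤-trans; ≤-reflexive; +-mono-≤; +-monoʳ-≤; m≤m+n; m≤n+m; +-comm; *-comm; *-monoʳ-≤;
         <-cmp; module ≤-Reasoning)
open import Data.Bool using (Bool; true; false; _∧_; _xor_) renaming (_≟_ to _≟ᵇ_)
open import Data.Bool.Properties using (xor-comm; ¬-not)
open import Data.Fin using (Fin; toℕ; _≟_)
open import Data.Fin.Properties using (toℕ-injective)
open import Data.Fin.Subset using (Subset; ∣_∣)
open import Data.Vec using ([]; _∷_; lookup)
open import Data.Nat.ListAction using (sum)
open import Data.List using (List; []; _∷_; _++_; [_])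
open import Data.List.Properties using (map-tabulate)
open import Data.List.Membership.Propositional using (_∈_)
open import Data.List.Relation.Unary.Any using (here; there)
open import Data.List.Relation.Unary.All as All using ()
open import Data.List.Relation.Unary.AllPairs using (_∷_)
open import Data.List.Relation.Unary.Unique.Propositional using (Unique)
open import Data.Product using (∃; ∃₂; _×_; _,_)
open import Data.Sum using (_⊎_; inj₁; inj₂)
open import Data.Empty using (⊥-elim)
open import Relation.Binary.PropositionalEquality using (_≡_; _≢_; refl; sym; trans; cong; cong₂; subst)
open import Relation.Binary using (tri<; tri≈; tri>)
open import Relation.Nullary using (yes; no)
open import Relation.Nullary.Decidable using (⌊_⌋)
open import Function.Base using (_∘_)
open import Function.Bundles using (_⇔_; Equivalence)

Σfin-suc : ∀ m (f : Fin (suc m) → ℕ) → Σfin (suc m) f ≡ f Fin.zero + Σfin m (f ∘ Fin.suc)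
Σfin-suc m f = cong (λ fs → f Fin.zero + sum fs)
  (trans (map-tabulate Fin.suc f) (sym (map-tabulate (λ k → k) (f ∘ Fin.suc))))

≤Σfin-suc : ∀ m (f : Fin (suc m) → ℕ) {a : ℕ} → a ≤ f Fin.zero + Σfin m (f ∘ Fin.suc) → a ≤ Σfin (suc m) f
≤Σfin-suc m f {a} = subst (a ≤_) (sym (Σfin-suc m f))

f≤Σfin : ∀ m (f : Fin m → ℕ) (k : Fin m) → f k ≤ Σfin m f
f≤Σfin (suc m) f Fin.zero = ≤Σfin-suc m f (m≤m+n _ _)
f≤Σfin (suc m) f (Fin.suc k) = ≤Σfin-suc m f (≤-trans (f≤Σfin m (f ∘ Fin.suc) k) (m≤n+m _ _))

f+f≤Σfin : ∀ m (f : Fin m → ℕ) {k₁ k₂ : Fin m} → k₁ ≢ k₂ → f k₁ + f k₂ ≤ Σfin m f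
f+f≤Σfin (suc m) f {Fin.zero} {Fin.zero} k₁≢k₂ = ⊥-elim (k₁≢k₂ refl)
f+f≤Σfin (suc m) f {Fin.zero} {Fin.suc k₂} _ =
  ≤Σfin-suc m f (+-monoʳ-≤ (f Fin.zero) (f≤Σfin m (f ∘ Fin.suc) k₂))
f+f≤Σfin (suc m) f {Fin.suc k₁} {Fin.zero} _ =
  ≤Σfin-suc m f (≤-trans (≤-reflexive (+-comm (f (Fin.suc k₁)) (f Fin.zero)))
                         (+-monoʳ-≤ (f Fin.zero) (f≤Σfin m (f ∘ Fin.suc) k₁)))
f+f≤Σfin (suc m) f {Fin.suc k₁} {Fin.suc k₂} k₁≢k₂ =
  ≤Σfin-suc m f (≤-trans (f+f≤Σfin m (f ∘ Fin.suc) (k₁≢k₂ ∘ cong Fin.suc)) (m≤n+m _ _))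

f+f≤Σfin² : ∀ m (f : Fin m → Fin m → ℕ) {i₁ j₁ i₂ j₂ : Fin m} → (i₁ , j₁) ≢ (i₂ , j₂) →
            f i₁ j₁ + f i₂ j₂ ≤ Σfin m (λ i → Σfin m (f i))
f+f≤Σfin² m f {i₁} {j₁} {i₂} {j₂} ij₁≢ij₂ with i₁ ≟ i₂
... | no i₁≢i₂ = ≤-trans (+-mono-≤ (f≤Σfin m (f i₁) j₁) (f≤Σfin m (f i₂) j₂))
                         (f+f≤Σfin m (λ i → Σfin m (f i)) i₁≢i₂)
... | yes refl = ≤-trans (f+f≤Σfin m (f i₁) (ij₁≢ij₂ ∘ cong (i₁ ,_)))
                         (f≤Σfin m (λ i → Σfin m (f i)) i₁)

∧≡true⇒× : ∀ {a b : Bool} → (a ∧ b) ≡ true → a ≡ true × b ≡ true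
∧≡true⇒× {true} {true} refl = refl , refl

∣∷∣ : ∀ {m} b (S : Subset m) → ∣ b ∷ S ∣ ≡ b2n b + ∣ S ∣
∣∷∣ true S = refl
∣∷∣ false S = refl

b2n-∧≤ : ∀ b c → b2n (b ∧ c) ≤ b2n b
b2n-∧≤ true true = s≤s z≤n
b2n-∧≤ true false = z≤n
b2n-∧≤ false c = z≤n

Σfin-b2n-∧≤∣∣ : ∀ {m} (S : Subset m) (h : Fin m → Bool) → Σfin m (λ k → b2n (lookup S k ∧ h k)) ≤ ∣ S ∣
Σfin-b2n-∧≤∣∣ [] h = z≤n
Σfin-b2n-∧≤∣∣ {suc m} (b ∷ S) h = begin
  Σfin (suc m) (λ k → b2n (lookup (b ∷ S) k ∧ h k))              ≡⟨ Σfin-suc m _ ⟩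
  b2n (b ∧ h Fin.zero) + Σfin m (λ k → b2n (lookup S k ∧ h (Fin.suc k)))
    ≤⟨ +-mono-≤ (b2n-∧≤ b (h Fin.zero)) (Σfin-b2n-∧≤∣∣ S (h ∘ Fin.suc)) ⟩
  b2n b + ∣ S ∣                                                  ≡⟨ sym (∣∷∣ b S) ⟩
  ∣ b ∷ S ∣                                                      ∎
  where open ≤-Reasoning

Σfin-b2n≡0⊎∃ : ∀ m (g : Fin m → Bool) → Σfin m (λ k → b2n (g k)) ≡ 0 ⊎ ∃ λ k → g k ≡ true
Σfin-b2n≡0⊎∃ zero g = inj₁ refl
Σfin-b2n≡0⊎∃ (suc m) g with g Fin.zero ≟ᵇ true | Σfin-b2n≡0⊎∃ m (g ∘ Fin.suc)
... | yes g₀ | _             = inj₂ (Fin.zero , g₀)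
... | no _   | inj₂ (k , gk) = inj₂ (Fin.suc k , gk)
... | no g₀  | inj₁ Σ≡0      =
  inj₁ (trans (Σfin-suc m (b2n ∘ g)) (cong₂ _+_ (cong b2n (¬-not g₀)) Σ≡0))

module _ {A : Set} (P : A → Bool) where

  first-exit : ∀ b m z → P b ≡ true → P z ≡ false →
          ∃₂ λ c d → Consec (b ∷ m ++ [ z ]) c d × P c ≡ true × P d ≡ false × d ∈ m ++ [ z ]
  first-exit b []      z Pb Pz = b , z , inj₁ (refl , refl) , Pb , Pz , here refl
  first-exit b (b′ ∷ m) z Pb Pz with P b′ ≟ᵇ true
  ... | no Pb′ = b , b′ , inj₁ (refl , refl) , Pb , ¬-not Pb′ , here refl
  ... | yes Pb′ with first-exit b′ m z Pb′ Pz
  ...   | c , d , cd , Pc , Pd , d∈ = c , d , inj₂ cd , Pc , Pd , there d∈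

  record EntersAndLeaves (l : List A) : Set where
    field
      u v c d : A
      enters : Consec l u v
      leaves : Consec l c d
      Pu : P u ≡ false
      Pv : P v ≡ true
      Pc : P c ≡ true
      Pd : P d ≡ false
      u≢d : u ≢ d

  EntersAndLeaves-∷ : ∀ {a b l} → EntersAndLeaves (b ∷ l) → EntersAndLeaves (a ∷ b ∷ l)
  EntersAndLeaves-∷ r = record
    { u = u ; v = v ; c = c ; d = d ; enters = inj₂ enters ; leaves = inj₂ leaves
    ; Pu = Pu ; Pv = Pv ; Pc = Pc ; Pd = Pd ; u≢d = u≢d }
    where open EntersAndLeaves r

  enters-and-leaves : ∀ a m z {w} → Unique (a ∷ m ++ [ z ]) → P a ≡ false → P z ≡ false →
                      w ∈ m → P w ≡ true → EntersAndLeaves (a ∷ m ++ [ z ])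
  enters-and-leaves a (b ∷ m) z (a∉ ∷ unique) Pa Pz w∈ Pw with P b ≟ᵇ true
  ... | yes Pb with first-exit b m z Pb Pz
  ...   | c , d , cd , Pc , Pd , d∈ =
    record { u = a ; v = b ; c = c ; d = d ; enters = inj₁ (refl , refl) ; leaves = inj₂ cd
           ; Pu = Pa ; Pv = Pb ; Pc = Pc ; Pd = Pd ; u≢d = All.lookup a∉ (there d∈) }
  enters-and-leaves a (b ∷ m) z (_ ∷ unique) Pa Pz (here refl) Pw | no Pb = ⊥-elim (Pb Pw)
  enters-and-leaves a (b ∷ m) z (_ ∷ unique) Pa Pz (there w∈) Pw | no Pb =
    EntersAndLeaves-∷ (enters-and-leaves b m z unique (¬-not Pb) Pz w∈ Pw)

Orients : {A : Set} → A → A → A → A → Set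
Orients i j u v = (i ≡ u × j ≡ v) ⊎ (i ≡ v × j ≡ u)

orientations-≢ : ∀ {A : Set} {i₁ j₁ i₂ j₂ u v c d : A} → Orients i₁ j₁ u v → Orients i₂ j₂ c d →
                 u ≢ c → u ≢ d → (i₁ , j₁) ≢ (i₂ , j₂)
orientations-≢ (inj₁ (refl , _)) (inj₁ (refl , _)) u≢c u≢d refl = u≢c refl
orientations-≢ (inj₁ (refl , _)) (inj₂ (refl , _)) u≢c u≢d refl = u≢d refl
orientations-≢ (inj₂ (_ , refl)) (inj₁ (_ , refl)) u≢c u≢d refl = u≢d refl
orientations-≢ (inj₂ (_ , refl)) (inj₂ (_ , refl)) u≢c u≢d refl = u≢c refl

xor≡true⇒≢ : ∀ {A : Set} (P : A → Bool) {u v : A} → (P u xor P v) ≡ true → u ≢ v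
xor≡true⇒≢ P {u} crosses refl with P u | crosses
... | true  | ()
... | false | ()

false-xor-true : ∀ {a b : Bool} → a ≡ false → b ≡ true → (a xor b) ≡ true
false-xor-true refl refl = refl

cutTerm : ∀ n → Subset n → (Vtx n → Vtx n → Bool) → Vtx n → Vtx n → ℕ
cutTerm n S x i j = b2n (⌊ toℕ i <? toℕ j ⌋ ∧ (inS S i xor inS S j) ∧ x i j)

cutTerm≡1 : ∀ {n} (S : Subset n) (x : Vtx n → Vtx n → Bool) {i j : Vtx n} → toℕ i < toℕ j →
            (inS S i xor inS S j) ≡ true → x i j ≡ true → cutTerm n S x i j ≡ 1
cutTerm≡1 S x {i} {j} i<j crosses xij with toℕ i <? toℕ j
... | no i≮j = ⊥-elim (i≮j i<j)
... | yes _ rewrite crosses | xij = refl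

crossing-edge : ∀ {n} (S : Subset n) (x : Vtx n → Vtx n → Bool) (route : List (Vtx n)) →
                (∀ i j → toℕ i < toℕ j → (x i j ≡ true) ⇔ (Consec route i j ⊎ Consec route j i)) →
                ∀ {u v} → Consec route u v → (inS S u xor inS S v) ≡ true →
                ∃₂ λ i j → cutTerm n S x i j ≡ 1 × Orients i j u v
crossing-edge S x route x⇔ {u} {v} uv crosses with <-cmp (toℕ u) (toℕ v)
... | tri< u<v _ _ =
  u , v , cutTerm≡1 S x u<v crosses (Equivalence.from (x⇔ u v u<v) (inj₁ uv)) , inj₁ (refl , refl)
... | tri≈ _ u≡v _ = ⊥-elim (xor≡true⇒≢ (inS S) crosses (toℕ-injective u≡v))
... | tri> _ _ v<u =
  v , u , cutTerm≡1 S x v<u (trans (xor-comm (inS S v) (inS S u)) crosses)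
                    (Equivalence.from (x⇔ v u v<u) (inj₂ uv)) , inj₂ (refl , refl)

inS-cust : ∀ {n} (S : Subset n) (c : Fin n) → inS S (cust c) ≡ lookup S c
inS-cust (b ∷ S) Fin.zero = refl
inS-cust (b ∷ S) (Fin.suc c) = inS-cust S c

inS-depot' : ∀ {n} (S : Subset n) → inS S (depot' {n}) ≡ false
inS-depot' [] = refl
inS-depot' (b ∷ S) = inS-depot' S

-- The entering edge {u, v} and the leaving edge {c, d} differ: u ∉ S ∋ c, and
-- u ≠ d because the route is simple.
route-meets-S⇒2≤cutSum : ∀ {n Vd x y} → Feasible n Vd x y → (S : Subset n) (k : Fin n) →
                         lookup S k ≡ true → y (cust k) ≡ true → 2 ≤ cutSum n S x
route-meets-S⇒2≤cutSum {n} {x = x} (_ , _ , _ , interior , unique , interior⇔ , x⇔) S k k∈S yk =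
  let k∈interior = Equivalence.from (interior⇔ (cust k)) ((k , refl) , yk)
      open EntersAndLeaves (enters-and-leaves (inS S) depot interior depot' unique refl
                              (inS-depot' S) k∈interior (trans (inS-cust S k) k∈S))
      route = depot ∷ interior ++ [ depot' ]
      (i₁ , j₁ , enter≡1 , enter-orients) =
        crossing-edge S x route x⇔ enters (false-xor-true Pu Pv)
      (i₂ , j₂ , leave≡1 , leave-orients) =
        crossing-edge S x route x⇔ leaves
          (trans (xor-comm (inS S c) (inS S d)) (false-xor-true Pd Pc))
      u≢c = xor≡true⇒≢ (inS S) (false-xor-true Pu Pc)
  in subst (_≤ cutSum n S x) (cong₂ _+_ enter≡1 leave≡1)
       (f+f≤Σfin² _ (cutTerm n S x) (orientations-≢ enter-orients leave-orients u≢c u≢d))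

proposition3 : ∀ (n : ℕ) (Vd : Subset n) (x : Vtx n → Vtx n → Bool) (y : Vtx n → Bool)
               → Feasible n Vd x y
               → (S : Subset n) → ∣ S ∣ ≥ 3
               → ∣ S ∣ * cutSum n S x ≥ 2 * ySum n S y
proposition3 n Vd x y feasible S _ with Σfin-b2n≡0⊎∃ n (λ k → lookup S k ∧ y (cust k))
... | inj₁ ySum≡0 = subst (λ t → 2 * t ≤ ∣ S ∣ * cutSum n S x) (sym ySum≡0) z≤n
... | inj₂ (k , k∈S∧yk) with ∧≡true⇒× k∈S∧yk
...   | k∈S , yk = begin
  2 * ySum n S y         ≤⟨ *-monoʳ-≤ 2 (Σfin-b2n-∧≤∣∣ S (y ∘ cust)) ⟩
  2 * ∣ S ∣              ≡⟨ *-comm 2 ∣ S ∣ ⟩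
  ∣ S ∣ * 2              ≤⟨ *-monoʳ-≤ ∣ S ∣ (route-meets-S⇒2≤cutSum {Vd = Vd} feasible S k k∈S yk) ⟩
  ∣ S ∣ * cutSum n S x   ∎
  where open ≤-Reasoning
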